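{- Let $\mathcal{S}$ be the groupoid with a single object $\mathsf{tt}$ whose morphisms $\mathsf{tt}\to\mathsf{tt}$ are the integers $\mathbb{Z}$ (composition is addition, identity is $0$), equipped with the algebra structure for the circle signature $S^1$ whose point constructor picks the object $\mathsf{tt}$ and whose path constructor is the natural transformation with component $1$. Then $\mathcal{S}$ is biinitial in $\mathrm{AlgG}(S^1)$.
   Context: The circle signature $S^1$ is the HIT-signature with point-constructor code $C_{\mathbf 1}$ (the constant code on the unit type), one path constructor with argument code $C_{\mathbf 1}$ and both endpoints equal to $\mathsf{constr}$, and no homotopy constructors. Unfolding the definition, the bicategory $\mathrm{AlgG}(S^1)$ of algebras in groupoids has as objects groupoids $G$ (hom-types sets, not necessarily univalent) with a functor $b$ from the one-object discrete groupoid (i.e. an object $b$ of $G$) and a natural transformation from $b$ to $b$ (i.e. a morphism $l:b\to b$); a 1-cell $(G,b,l)\to(G',b',l')$ is a functor $F:G\to G'$ with an isomorphism $\varphi:F(b)\cong b'$ satisfying $F(l)\cdot\varphi=\varphi\cdot l'$; a 2-cell $(F,\varphi)\Rightarrow(F',\varphi')$ is a natural transformation $\theta:F\Rightarrow F'$ with $\theta_b\cdot\varphi'=\varphi$. An object of a bicategory is biinitial if for every object there is a 1-cell to it, any two such 1-cells are related by a 2-cell, and any two parallel such 2-cells are equal. -}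

module Defs where

open import Level using (Level; _⊔_; 0ℓ) renaming (suc to lsuc)
open import Data.Unit using (⊤; tt)
open import Data.Integer using (ℤ; _+_; -_; 0ℤ; 1ℤ)
open import Data.Integer.Properties as ℤP using ()
open import Relation.Binary.PropositionalEquality using (_≡_; refl)
import Axiom.UniquenessOfIdentityProofs as UIP

-- Groupoids: hom-types are sets (not necessarily univalent).
-- Composition is written diagrammatically: f · g means "first f, then g".
record Groupoid (o h : Level) : Set (lsuc (o ⊔ h)) where
  infixr 9 _·_
  field
    Ob    : Set o
    Hom   : Ob → Ob → Set h
    idm   : ∀ {x} → Hom x x
    _·_   : ∀ {x y z} → Hom x y → Hom y z → Hom x z
    inv   : ∀ {x y} → Hom x y → Hom y x
    idl   : ∀ {x y} (f : Hom x y) → idm · f ≡ f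
    idr   : ∀ {x y} (f : Hom x y) → f · idm ≡ f
    assoc : ∀ {w x y z} (f : Hom w x) (g : Hom x y) (k : Hom y z)
            → (f · g) · k ≡ f · (g · k)
    invl  : ∀ {x y} (f : Hom x y) → inv f · f ≡ idm
    invr  : ∀ {x y} (f : Hom x y) → f · inv f ≡ idm
    homSet : ∀ {x y} {f g : Hom x y} (p q : f ≡ g) → p ≡ q

open Groupoid public

record Functor {o h o' h'} (G : Groupoid o h) (G' : Groupoid o' h')
       : Set (o ⊔ h ⊔ o' ⊔ h') where
  private
    module G = Groupoid G
    module G' = Groupoid G'
  field
    F₀    : G.Ob → G'.Ob
    F₁    : ∀ {x y} → G.Hom x y → G'.Hom (F₀ x) (F₀ y)
    F-id  : ∀ {x} → F₁ (G.idm {x}) ≡ G'.idm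
    F-comp : ∀ {x y z} (f : G.Hom x y) (g : G.Hom y z)
             → F₁ (f G.· g) ≡ F₁ f G'.· F₁ g

open Functor public

record NatTrans {o h o' h'} {G : Groupoid o h} {G' : Groupoid o' h'}
       (F K : Functor G G') : Set (o ⊔ h ⊔ h') where
  private
    module G = Groupoid G
    module G' = Groupoid G'
  field
    η   : ∀ x → G'.Hom (F₀ F x) (F₀ K x)
    nat : ∀ {x y} (f : G.Hom x y) → F₁ F f G'.· η y ≡ η x G'.· F₁ K f

open NatTrans public

-- Algebras for the circle signature S¹ in groupoids (unfolded):
-- a groupoid with a point (functor from the one-object discrete groupoid)
-- and a loop (natural transformation from that functor to itself).
record S1Alg (o h : Level) : Set (lsuc (o ⊔ h)) where
  field
    carrier : Groupoid o h
    base    : Ob carrier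
    loop    : Hom carrier base base

open S1Alg public

record S1Alg1Cell {o h o' h'} (X : S1Alg o h) (Y : S1Alg o' h')
       : Set (o ⊔ h ⊔ o' ⊔ h') where
  private
    module Y = Groupoid (carrier Y)
  field
    fun  : Functor (carrier X) (carrier Y)
    -- every morphism of a groupoid is an isomorphism
    φ    : Y.Hom (F₀ fun (base X)) (base Y)
    comm : F₁ fun (loop X) Y.· φ ≡ φ Y.· loop Y

open S1Alg1Cell public

record S1Alg2Cell {o h o' h'} {X : S1Alg o h} {Y : S1Alg o' h'}
       (f g : S1Alg1Cell X Y) : Set (o ⊔ h ⊔ h') where
  private
    module Y = Groupoid (carrier Y)
  field
    θ    : NatTrans (fun f) (fun g)
    comm : η θ (base X) Y.· φ g ≡ φ f

open S1Alg2Cell public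

-- Equality of 2-cells = equality of their underlying natural
-- transformations, i.e. componentwise equality (the remaining data are
-- propositions since hom-types are sets).
record IsBiinitial {o h} (X : S1Alg o h) (o' h' : Level)
       : Set (o ⊔ h ⊔ lsuc (o' ⊔ h')) where
  field
    to   : (Y : S1Alg o' h') → S1Alg1Cell X Y
    cell : (Y : S1Alg o' h') (f g : S1Alg1Cell X Y) → S1Alg2Cell f g
    uniq : (Y : S1Alg o' h') (f g : S1Alg1Cell X Y) (α β : S1Alg2Cell f g)
           → ∀ x → η (θ α) x ≡ η (θ β) x

ℤGroupoid : Groupoid 0ℓ 0ℓ
ℤGroupoid = record
  { Ob = ⊤
  ; Hom = λ _ _ → ℤ
  ; idm = 0ℤ
  ; _·_ = _+_
  ; inv = -_
  ; idl = ℤP.+-identityˡ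
  ; idr = ℤP.+-identityʳ
  ; assoc = ℤP.+-assoc
  ; invl = ℤP.+-inverseˡ
  ; invr = ℤP.+-inverseʳ
  ; homSet = UIP.Decidable⇒UIP.≡-irrelevant ℤP._≟_
  }

𝒮 : S1Alg 0ℓ 0ℓ
𝒮 = record { carrier = ℤGroupoid ; base = tt ; loop = 1ℤ }

-- The 1-cell out of 𝒮 sends n to the n-th power of the loop.  Conversely a
-- functor out of ℤGroupoid is determined by the image a of 1 (it sends n to
-- aⁿ), and the 1-cell condition says that φ conjugates a into the loop, hence
-- aⁿ into loopⁿ.  So for two 1-cells f, g the morphism φ_f · φ_g⁻¹ is natural,
-- giving the 2-cell; and the 2-cell condition θ · φ_g = φ_f determines θ by
-- cancellation, giving uniqueness.
module Submission where

open import Defs hiding (Ob; Hom; idm; _·_; inv; idl; idr; assoc; invl; invr; homSet)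
open import Level using (Level)
open import Data.Unit using (tt)
open import Data.Nat as ℕ using ()
open import Data.Integer using (ℤ; +_; -[1+_]; 0ℤ; 1ℤ; -1ℤ; _+_; suc; pred)
open import Data.Integer.Properties using (+-identityˡ; +-assoc)
open import Relation.Binary.PropositionalEquality

ℤ-induction : ∀ {ℓ} (P : ℤ → Set ℓ) → P 0ℤ → (∀ z → P z → P (suc z))
              → (∀ z → P z → P (pred z)) → ∀ z → P z
ℤ-induction P base step-suc step-pred (+ ℕ.zero)    = base
ℤ-induction P base step-suc step-pred (+ ℕ.suc n)   =
  step-suc (+ n) (ℤ-induction P base step-suc step-pred (+ n))
ℤ-induction P base step-suc step-pred -[1+ ℕ.zero ]  = step-pred 0ℤ base
ℤ-induction P base step-suc step-pred -[1+ ℕ.suc n ] =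
  step-pred -[1+ n ] (ℤ-induction P base step-suc step-pred -[1+ n ])

module GroupoidProperties {o h} (G : Groupoid o h) where
  open Groupoid G using (Ob; Hom; idm; _·_; inv; idl; idr; assoc; invl; invr)
  open ≡-Reasoning

  private
    variable
      x y z : Ob

  ·-inv-cancelʳ : (a : Hom x y) (c : Hom z y) → (a · inv c) · c ≡ a
  ·-inv-cancelʳ a c = begin
    (a · inv c) · c ≡⟨ assoc a (inv c) c ⟩
    a · (inv c · c) ≡⟨ cong (a ·_) (invl c) ⟩
    a · idm         ≡⟨ idr a ⟩
    a               ∎

  ·-cancelʳ-inv : (a : Hom x y) (c : Hom y z) → (a · c) · inv c ≡ a
  ·-cancelʳ-inv a c = begin
    (a · c) · inv c ≡⟨ assoc a c (inv c) ⟩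
    a · (c · inv c) ≡⟨ cong (a ·_) (invr c) ⟩
    a · idm         ≡⟨ idr a ⟩
    a               ∎

  inv-cancelˡ-· : (a : Hom x y) (c : Hom y z) → inv a · (a · c) ≡ c
  inv-cancelˡ-· a c = begin
    inv a · (a · c) ≡⟨ assoc (inv a) a c ⟨
    (inv a · a) · c ≡⟨ cong (_· c) (invl a) ⟩
    idm · c         ≡⟨ idl c ⟩
    c               ∎

  cancelˡ-inv-· : (a : Hom x y) (c : Hom x z) → a · (inv a · c) ≡ c
  cancelˡ-inv-· a c = begin
    a · (inv a · c) ≡⟨ assoc a (inv a) c ⟨
    (a · inv a) · c ≡⟨ cong (_· c) (invr a) ⟩
    idm · c         ≡⟨ idl c ⟩
    c               ∎

  cancelʳ : ∀ {a b : Hom x y} (c : Hom y z) → a · c ≡ b · c → a ≡ b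
  cancelʳ {a = a} {b} c ac≡bc = begin
    a               ≡⟨ ·-cancelʳ-inv a c ⟨
    (a · c) · inv c ≡⟨ cong (_· inv c) ac≡bc ⟩
    (b · c) · inv c ≡⟨ ·-cancelʳ-inv b c ⟩
    b               ∎

  inverseˡ-unique : ∀ {a : Hom x y} {b : Hom y x} → a · b ≡ idm → a ≡ inv b
  inverseˡ-unique {a = a} {b} ab≡id = begin
    a               ≡⟨ ·-cancelʳ-inv a b ⟨
    (a · b) · inv b ≡⟨ cong (_· inv b) ab≡id ⟩
    idm · inv b     ≡⟨ idl (inv b) ⟩
    inv b           ∎

  -- "a · φ ≡ φ · b" reads: φ conjugates a into b.
  conj-inv : ∀ {a : Hom x x} {b : Hom y y} {φ : Hom x y} →
             a · φ ≡ φ · b → inv a · φ ≡ φ · inv b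
  conj-inv {a = a} {b} {φ} aφ≡φb = cancelʳ b (begin
    (inv a · φ) · b ≡⟨ assoc (inv a) φ b ⟩
    inv a · (φ · b) ≡⟨ cong (inv a ·_) aφ≡φb ⟨
    inv a · (a · φ) ≡⟨ inv-cancelˡ-· a φ ⟩
    φ               ≡⟨ ·-inv-cancelʳ φ b ⟨
    (φ · inv b) · b ∎)

  conj-transpose : ∀ {a : Hom x x} {b : Hom y y} {φ : Hom x y} →
                   a · φ ≡ φ · b → b · inv φ ≡ inv φ · a
  conj-transpose {a = a} {b} {φ} aφ≡φb = cancelʳ φ (begin
    (b · inv φ) · φ ≡⟨ ·-inv-cancelʳ b φ ⟩
    b               ≡⟨ inv-cancelˡ-· φ b ⟨
    inv φ · (φ · b) ≡⟨ cong (inv φ ·_) aφ≡φb ⟨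
    inv φ · (a · φ) ≡⟨ assoc (inv φ) a φ ⟨
    (inv φ · a) · φ ∎)

  conj-through : ∀ {w} {a : Hom x x} {c : Hom y y} {p : Hom w w}
                 {φ : Hom x w} {ψ : Hom y w} →
                 a · φ ≡ φ · p → c · ψ ≡ ψ · p → a · (φ · inv ψ) ≡ (φ · inv ψ) · c
  conj-through {a = a} {c} {p} {φ} {ψ} aφ≡φp cψ≡ψp = begin
    a · (φ · inv ψ) ≡⟨ assoc a φ (inv ψ) ⟨
    (a · φ) · inv ψ ≡⟨ cong (_· inv ψ) aφ≡φp ⟩
    (φ · p) · inv ψ ≡⟨ assoc φ p (inv ψ) ⟩
    φ · (p · inv ψ) ≡⟨ cong (φ ·_) (conj-transpose cψ≡ψp) ⟩
    φ · (inv ψ · c) ≡⟨ assoc φ (inv ψ) c ⟨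
    (φ · inv ψ) · c ∎

  infixl 10 _^_

  _^_ : Hom x x → ℤ → Hom x x
  l ^ (+ ℕ.zero)      = idm
  l ^ (+ ℕ.suc n)     = l · l ^ (+ n)
  l ^ -[1+ ℕ.zero ]   = inv l
  l ^ -[1+ ℕ.suc n ]  = inv l · l ^ -[1+ n ]

  ^-suc : (l : Hom x x) (z : ℤ) → l ^ suc z ≡ l · l ^ z
  ^-suc l (+ n)            = refl
  ^-suc l -[1+ ℕ.zero ]    = sym (invr l)
  ^-suc l -[1+ ℕ.suc n ]   = sym (cancelˡ-inv-· l (l ^ -[1+ n ]))

  ^-pred : (l : Hom x x) (z : ℤ) → l ^ pred z ≡ inv l · l ^ z
  ^-pred l (+ ℕ.zero)  = sym (idr (inv l))
  ^-pred l (+ ℕ.suc n) = sym (inv-cancelˡ-· l (l ^ (+ n)))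
  ^-pred l -[1+ n ]    = refl

  ^-homo : (l : Hom x x) (m n : ℤ) → l ^ (m + n) ≡ l ^ m · l ^ n
  ^-homo l = ℤ-induction (λ m → ∀ n → l ^ (m + n) ≡ l ^ m · l ^ n)
    (λ n → trans (cong (l ^_) (+-identityˡ n)) (sym (idl (l ^ n))))
    (λ m ih n → begin
      l ^ (suc m + n)       ≡⟨ cong (l ^_) (+-assoc 1ℤ m n) ⟩
      l ^ suc (m + n)       ≡⟨ ^-suc l (m + n) ⟩
      l · l ^ (m + n)       ≡⟨ cong (l ·_) (ih n) ⟩
      l · (l ^ m · l ^ n)   ≡⟨ assoc l (l ^ m) (l ^ n) ⟨
      (l · l ^ m) · l ^ n   ≡⟨ cong (_· l ^ n) (^-suc l m) ⟨
      l ^ suc m · l ^ n     ∎)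
    (λ m ih n → begin
      l ^ (pred m + n)         ≡⟨ cong (l ^_) (+-assoc -1ℤ m n) ⟩
      l ^ pred (m + n)         ≡⟨ ^-pred l (m + n) ⟩
      inv l · l ^ (m + n)      ≡⟨ cong (inv l ·_) (ih n) ⟩
      inv l · (l ^ m · l ^ n)  ≡⟨ assoc (inv l) (l ^ m) (l ^ n) ⟨
      (inv l · l ^ m) · l ^ n  ≡⟨ cong (_· l ^ n) (^-pred l m) ⟨
      l ^ pred m · l ^ n       ∎)

  conj-· : ∀ {a c : Hom x x} {b d : Hom y y} {φ : Hom x y} →
           a · φ ≡ φ · b → c · φ ≡ φ · d → (a · c) · φ ≡ φ · (b · d)
  conj-· {a = a} {c} {b} {d} {φ} aφ≡φb cφ≡φd = begin
    (a · c) · φ ≡⟨ assoc a c φ ⟩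
    a · (c · φ) ≡⟨ cong (a ·_) cφ≡φd ⟩
    a · (φ · d) ≡⟨ assoc a φ d ⟨
    (a · φ) · d ≡⟨ cong (_· d) aφ≡φb ⟩
    (φ · b) · d ≡⟨ assoc φ b d ⟩
    φ · (b · d) ∎

  conj-^ : ∀ {a : Hom x x} {b : Hom y y} {φ : Hom x y} →
           a · φ ≡ φ · b → ∀ z → a ^ z · φ ≡ φ · b ^ z
  conj-^ {a = a} {b} {φ} aφ≡φb = ℤ-induction (λ z → a ^ z · φ ≡ φ · b ^ z)
    (trans (idl φ) (sym (idr φ)))
    (λ z ih → begin
      a ^ suc z · φ       ≡⟨ cong (_· φ) (^-suc a z) ⟩
      (a · a ^ z) · φ     ≡⟨ conj-· aφ≡φb ih ⟩
      φ · (b · b ^ z)     ≡⟨ cong (φ ·_) (^-suc b z) ⟨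
      φ · b ^ suc z       ∎)
    (λ z ih → begin
      a ^ pred z · φ          ≡⟨ cong (_· φ) (^-pred a z) ⟩
      (inv a · a ^ z) · φ     ≡⟨ conj-· (conj-inv aφ≡φb) ih ⟩
      φ · (inv b · b ^ z)     ≡⟨ cong (φ ·_) (^-pred b z) ⟨
      φ · b ^ pred z          ∎)

  module _ (F : Functor ℤGroupoid G) where
    F₁-neg : F₁ F -1ℤ ≡ inv (F₁ F 1ℤ)
    F₁-neg = inverseˡ-unique (trans (sym (F-comp F -1ℤ 1ℤ)) (F-id F))

    F₁≡^ : ∀ z → F₁ F z ≡ F₁ F 1ℤ ^ z
    F₁≡^ = ℤ-induction (λ z → F₁ F z ≡ F₁ F 1ℤ ^ z)
      (F-id F)
      (λ z ih → begin
        F₁ F (1ℤ + z)               ≡⟨ F-comp F 1ℤ z ⟩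
        F₁ F 1ℤ · F₁ F z            ≡⟨ cong (F₁ F 1ℤ ·_) ih ⟩
        F₁ F 1ℤ · F₁ F 1ℤ ^ z       ≡⟨ ^-suc (F₁ F 1ℤ) z ⟨
        F₁ F 1ℤ ^ suc z             ∎)
      (λ z ih → begin
        F₁ F (-1ℤ + z)              ≡⟨ F-comp F -1ℤ z ⟩
        F₁ F -1ℤ · F₁ F z           ≡⟨ cong₂ _·_ F₁-neg ih ⟩
        inv (F₁ F 1ℤ) · F₁ F 1ℤ ^ z ≡⟨ ^-pred (F₁ F 1ℤ) z ⟨
        F₁ F 1ℤ ^ pred z            ∎)

module _ {o' h'} (Y : S1Alg o' h') where
  open Groupoid (carrier Y) using (idm; _·_; inv; idl; idr)
  open GroupoidProperties (carrier Y)

  S¹-rec : S1Alg1Cell 𝒮 Y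
  S¹-rec = record
    { fun  = record
      { F₀ = λ _ → base Y ; F₁ = loop Y ^_ ; F-id = refl ; F-comp = ^-homo (loop Y) }
    ; φ    = idm
    ; comm = trans (idr (loop Y ^ 1ℤ)) (trans (idr (loop Y)) (sym (idl (loop Y))))
    }

  φ-conj-^ : (f : S1Alg1Cell 𝒮 Y) (z : ℤ) → F₁ (fun f) z · φ f ≡ φ f · loop Y ^ z
  φ-conj-^ f z = trans (cong (_· φ f) (F₁≡^ (fun f) z)) (conj-^ (comm f) z)

  S¹-2cell : (f g : S1Alg1Cell 𝒮 Y) → S1Alg2Cell f g
  S¹-2cell f g = record
    { θ    = record
      { η   = λ _ → φ f · inv (φ g)
      ; nat = λ z → conj-through (φ-conj-^ f z) (φ-conj-^ g z)
      }
    ; comm = ·-inv-cancelʳ (φ f) (φ g)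
    }

  S¹-2cell-unique : (f g : S1Alg1Cell 𝒮 Y) (α β : S1Alg2Cell f g) →
                    ∀ x → η (θ α) x ≡ η (θ β) x
  S¹-2cell-unique f g α β tt =
    cancelʳ (φ g) (trans (S1Alg2Cell.comm α) (sym (S1Alg2Cell.comm β)))

proposition11p5 : (o' h' : Level) → IsBiinitial 𝒮 o' h'
proposition11p5 o' h' = record { to = S¹-rec ; cell = S¹-2cell ; uniq = S¹-2cell-unique }
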